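{- Consider the algorithm described in the context, applied to a bipartite graph $G=(A\cup B,E)$ with $V_p\subseteq A$. The vertex cover $\mathcal{C}_{ALG}$ computed by the algorithm contains all priceable vertices.
   Context: Setting: bipartite graph $G=(A\cup B,E)$, $E\subseteq A\times B$, vertices partitioned into priceable $V_p\subseteq A$ (prices $p(v)\ge0$) and fixed-price $V_f$ (costs $c(v)\ge0$). The flow network $G_d$ adds a source $s$ with directed edges $(s,v)$ for all $v\in A$ and a sink $t$ with directed edges $(v,t)$ for all $v\in B$; edge $(s,v)$ or $(v,t)$ has capacity $p(v)$ if $v\in V_p$ and $c(v)$ if $v\in V_f$; original edges are directed from $A$ to $B$ with infinite capacity. An augmenting path (w.r.t. the current flow) traverses forward edges with slack capacity and backward edges with nonzero flow. Algorithm: (1) construct $G_d$; (2) set $p(v)=0$ for all $v\in V_p$; (3) compute a maximum $s$-$t$-flow $\phi$ in $G_d$; (4) while there is $v\in V_p$ such that increasing $p(v)$ yields an augmenting $s$-$t$-path $P$, increase $p(v)$ and $\phi$ along $P$ as much as possible. $\mathcal{C}_{ALG}$ is the minimum vertex cover of $G$ (w.r.t. the final prices and costs) associated with the final maximum flow via the minimum cut: it contains each $v\in A$ such that no augmenting path from $s$ to $v$ exists, and each $w\in B$ such that an augmenting path from $s$ to $w$ exists.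
   Formalization: The prices $p(v)$, the costs $c(v)$ and the flows take values in ℚ. -}

module Defs where

open import Data.Bool using (Bool; true; false; if_then_else_; _∧_; _∨_)
open import Data.Nat using (ℕ; zero; suc)
open import Data.Fin using (Fin; zero; suc)
import Data.Fin as Fin
open import Data.Rational using (ℚ; 0ℚ; _+_; _-_; _≤_; _<_)
open import Data.List using (List; []; _∷_)
open import Data.List.Relation.Unary.Unique.Propositional using (Unique)
open import Data.Product using (Σ; _×_; _,_; ∃)
open import Relation.Nullary using (¬_; does)
open import Relation.Binary.PropositionalEquality using (_≡_)
open import Relation.Binary.Construct.Closure.ReflexiveTransitive using (Star; ε; _◅_)

Σℚ : ∀ {k} → (Fin k → ℚ) → ℚ
Σℚ {zero}  f = 0ℚ
Σℚ {suc k} f = f zero + Σℚ (λ i → f (suc i))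

-- Nodes of the flow network G_d: source, sink, A = Fin m, B = Fin n.
data Node (m n : ℕ) : Set where
  src : Node m n
  snk : Node m n
  nA  : Fin m → Node m n
  nB  : Fin n → Node m n

_==N_ : ∀ {m n} → Node m n → Node m n → Bool
src  ==N src  = true
snk  ==N snk  = true
nA a ==N nA a' = does (a Fin.≟ a')
nB b ==N nB b' = does (b Fin.≟ b')
_    ==N _    = false

usesL : ∀ {m n} → List (Node m n) → Node m n → Node m n → Bool
usesL []            u v = false
usesL (x ∷ [])      u v = false
usesL (x ∷ y ∷ xs)  u v = ((x ==N u) ∧ (y ==N v)) ∨ usesL (y ∷ xs) u v

-- A flow in G_d: on edges (s,a), (b,t) and (a,b).
record Flow (m n : ℕ) : Set where
  constructor mkFlow
  field
    fA : Fin m → ℚ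
    fB : Fin n → ℚ
    fE : Fin m → Fin n → ℚ
open Flow public

upd : ∀ {m} → (Fin m → ℚ) → Fin m → ℚ → Fin m → ℚ
upd p v x a = if does (a Fin.≟ v) then x else p a

-- The algorithm, for a fixed instance:
--   E  : edge set of G (E a b ≡ true iff (a,b) ∈ E),
--   Vp : priceable vertices (subset of A),
--   cA, cB : costs of fixed-price vertices (cA a only used when a ∉ Vp).
module Alg {m n : ℕ} (E : Fin m → Fin n → Bool) (Vp : Fin m → Bool)
           (cA : Fin m → ℚ) (cB : Fin n → ℚ) where

  Prices : Set
  Prices = Fin m → ℚ

  capA : Prices → Fin m → ℚ
  capA p a = if Vp a then p a else cA a

  capB : Fin n → ℚ
  capB = cB

  -- feasible s-t flow in G_d (edges A→B have infinite capacity)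
  record Feasible (p : Prices) (φ : Flow m n) : Set where
    field
      fA-nonneg : ∀ a → 0ℚ ≤ fA φ a
      fA-cap    : ∀ a → fA φ a ≤ capA p a
      fB-nonneg : ∀ b → 0ℚ ≤ fB φ b
      fB-cap    : ∀ b → fB φ b ≤ capB b
      fE-nonneg : ∀ a b → 0ℚ ≤ fE φ a b
      fE-edge   : ∀ a b → E a b ≡ false → fE φ a b ≡ 0ℚ
      cons-A    : ∀ a → fA φ a ≡ Σℚ (λ b → fE φ a b)
      cons-B    : ∀ b → Σℚ (λ a → fE φ a b) ≡ fB φ b

  value : Flow m n → ℚ
  value φ = Σℚ (fA φ)

  MaxFlow : Prices → Flow m n → Set
  MaxFlow p φ = Feasible p φ × (∀ ψ → Feasible p ψ → value ψ ≤ value φ)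

  data Res (p : Prices) (φ : Flow m n) : Node m n → Node m n → Set where
    s→a : ∀ {a} → fA φ a < capA p a → Res p φ src (nA a)
    a→s : ∀ {a} → 0ℚ < fA φ a → Res p φ (nA a) src
    a→b : ∀ {a b} → E a b ≡ true → Res p φ (nA a) (nB b)
    b→a : ∀ {a b} → 0ℚ < fE φ a b → Res p φ (nB b) (nA a)
    b→t : ∀ {b} → fB φ b < capB b → Res p φ (nB b) snk
    t→b : ∀ {b} → 0ℚ < fB φ b → Res p φ snk (nB b)

  Walk : Prices → Flow m n → Node m n → Node m n → Set
  Walk p φ = Star (Res p φ)

  nodes : ∀ {p φ x y} → Walk p φ x y → List (Node m n)
  nodes {x = x} ε = x ∷ []
  nodes (_◅_ {i} r w) = i ∷ nodes w

  AugPath : Prices → Flow m n → Node m n → Node m n → Set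
  AugPath p φ x y = Σ (Walk p φ x y) (λ P → Unique (nodes P))

  shift : Bool → ℚ → ℚ
  shift b δ = if b then δ else 0ℚ

  augment : Flow m n → List (Node m n) → ℚ → Flow m n
  augment φ P δ = mkFlow
    (λ a → (fA φ a + shift (usesL P src (nA a)) δ) - shift (usesL P (nA a) src) δ)
    (λ b → (fB φ b + shift (usesL P (nB b) snk) δ) - shift (usesL P snk (nB b)) δ)
    (λ a b → (fE φ a b + shift (usesL P (nA a) (nB b)) δ) - shift (usesL P (nB b) (nA a)) δ)

  Guard : Prices → Flow m n → Fin m → Set
  Guard p φ v = (Vp v ≡ true) ×
    ∃ λ ε → (0ℚ < ε) × AugPath (upd p v (p v + ε)) φ src snk

  State : Set
  State = Flow m n × Prices

  data Step : State → State → Set where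
    step : ∀ {φ p} (v : Fin m) (ε : ℚ) (P : Walk (upd p v (p v + ε)) φ src snk) (δ : ℚ) →
           Vp v ≡ true → 0ℚ < ε → Unique (nodes P) →
           Feasible (upd p v (p v + δ)) (augment φ (nodes P) δ) →
           (∀ δ' → δ < δ' → ¬ Feasible (upd p v (p v + δ')) (augment φ (nodes P) δ')) →
           Step (φ , p) (augment φ (nodes P) δ , upd p v (p v + δ))

  p₀ : Prices
  p₀ = λ _ → 0ℚ

  FinalState : Flow m n → Prices → Set
  FinalState φ p =
    (∃ λ φ₀ → MaxFlow p₀ φ₀ × Star Step (φ₀ , p₀) (φ , p)) ×
    (∀ v → ¬ Guard p φ v)

  InCoverA : Prices → Flow m n → Fin m → Set
  InCoverA p φ a = ¬ AugPath p φ src (nA a)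

  InCoverB : Prices → Flow m n → Fin n → Set
  InCoverB p φ b = AugPath p φ src (nB b)

-- The algorithm maintains an s-t cut S of G_d that no residual edge leaves and that contains
-- no priceable vertex. Initially S is the set of vertices reachable from s: t is unreachable
-- because the flow is maximum (a residual s-t walk, shortened to pass each vertex of B at most
-- once, would carry a larger flow), and a priceable vertex has capacity p(v) = 0, so it carries
-- no flow and no residual edge enters it. An iteration raises p(v) and augments along a simple
-- path s -> v -> ... -> t. Every vertex after s on that path reaches t without passing s, so it
-- lies outside S; hence augmenting changes no residual edge leaving S, except s -> v, whose
-- capacity and flow grow by the same amount. So at the end s still reaches no priceable vertex.

module Submission where

open import Defs
open import Data.Bool using (Bool; true; false; if_then_else_; _∧_; _∨_)
open import Data.Bool.Properties using (¬-not; ∧-conicalˡ; ∧-conicalʳ)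
open import Data.Empty using (⊥-elim)
open import Data.Fin using (Fin; zero; suc)
import Data.Fin as Fin
open import Data.List using (List; []; _∷_; drop)
open import Data.List.Membership.Propositional using (_∈_; _∉_)
open import Data.List.Relation.Unary.All as All using (All; []; _∷_)
open import Data.List.Relation.Unary.All.Properties using (All¬⇒¬Any)
open import Data.List.Relation.Unary.AllPairs using ([]; _∷_)
open import Data.List.Relation.Unary.Any using (here; there)
open import Data.List.Relation.Unary.Unique.Propositional using (Unique)
open import Data.Nat using (ℕ; zero; suc)
open import Data.Product using (Σ; _×_; _,_; proj₁; proj₂; ∃)
open import Data.Rational using (ℚ; 0ℚ; _≤_; _<_; _+_; _-_; -_; _⊓_)
open import Data.Rational.Properties
open import Data.Rational.Solver using (module +-*-Solver)
open import Data.Sum using (_⊎_; inj₁; inj₂; [_,_]′)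
open import Function using (_∘_; id; case_of_)
open import Relation.Binary.Construct.Closure.ReflexiveTransitive using (Star; ε; _◅_; _◅◅_)
open import Relation.Binary.PropositionalEquality
open import Relation.Nullary using (¬_; yes; no; contradiction)
open import Relation.Nullary.Decidable using (dec-true)

open +-*-Solver

private variable
  p q r : ℚ

<⇒≱ : p < q → ¬ (q ≤ p)
<⇒≱ p<q q≤p = <-irrefl refl (<-≤-trans p<q q≤p)

+-nonNeg : 0ℚ ≤ p → 0ℚ ≤ q → 0ℚ ≤ p + q
+-nonNeg {p} {q} 0≤p 0≤q = subst (_≤ p + q) (+-identityʳ 0ℚ) (+-mono-≤ 0≤p 0≤q)

p<p+q : 0ℚ < q → p < p + q
p<p+q {q} {p} 0<q = subst (_< p + q) (+-identityʳ p) (+-monoʳ-< p 0<q)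

p≤q⇒0≤q-p : p ≤ q → 0ℚ ≤ q - p
p≤q⇒0≤q-p {p} {q} p≤q = subst (_≤ q - p) (+-inverseʳ p) (+-monoˡ-≤ (- p) p≤q)

p<q⇒0<q-p : p < q → 0ℚ < q - p
p<q⇒0<q-p {p} {q} p<q = subst (_< q - p) (+-inverseʳ p) (+-monoˡ-< (- p) p<q)

r≤q-p⇒p+r≤q : r ≤ q - p → p + r ≤ q
r≤q-p⇒p+r≤q {r} {q} {p} r≤q-p =
  subst (p + r ≤_) (solve 2 (λ p q → p :+ (q :- p) := q) refl p q) (+-monoʳ-≤ p r≤q-p)

+-cancelʳ-< : ∀ r → p + r < q + r → p < q
+-cancelʳ-< {p} {q} r p+r<q+r = subst₂ _<_ (+r-r p) (+r-r q) (+-monoˡ-< (- r) p+r<q+r)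
  where
  +r-r : ∀ x → (x + r) + (- r) ≡ x
  +r-r x = solve 2 (λ x r → (x :+ r) :+ (:- r) := x) refl x r

0≤q+[r-p] : p ≤ q → 0ℚ ≤ r → 0ℚ ≤ q + (r - p)
0≤q+[r-p] {p} {q} {r} p≤q 0≤r =
  subst (0ℚ ≤_) (solve 3 (λ p q r → r :+ (q :- p) := q :+ (r :- p)) refl p q r)
        (+-nonNeg 0≤r (p≤q⇒0≤q-p p≤q))

⊓-pos : 0ℚ < p → 0ℚ < q → 0ℚ < p ⊓ q
⊓-pos {p} {q} 0<p 0<q with ⊓-sel p q
... | inj₁ p⊓q≡p = subst (0ℚ <_) (sym p⊓q≡p) 0<p
... | inj₂ p⊓q≡q = subst (0ℚ <_) (sym p⊓q≡q) 0<q

Σℚ-zero : ∀ {k} → Σℚ {k} (λ _ → 0ℚ) ≡ 0ℚ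
Σℚ-zero {zero}  = refl
Σℚ-zero {suc k} = trans (cong (0ℚ +_) (Σℚ-zero {k})) (+-identityʳ 0ℚ)

Σℚ-+ : ∀ {k} (f g : Fin k → ℚ) → Σℚ (λ i → f i + g i) ≡ Σℚ f + Σℚ g
Σℚ-+ {zero}  f g = sym (+-identityʳ 0ℚ)
Σℚ-+ {suc k} f g = trans
  (cong (f zero + g zero +_) (Σℚ-+ (λ i → f (suc i)) (λ i → g (suc i))))
  (solve 4 (λ a b c d → (a :+ b) :+ (c :+ d) := (a :+ c) :+ (b :+ d)) refl (f zero) (g zero) _ _)

Σℚ-diff : ∀ {k} (f g : Fin k → ℚ) → Σℚ (λ i → f i - g i) ≡ Σℚ f - Σℚ g
Σℚ-diff {zero}  f g = refl
Σℚ-diff {suc k} f g = trans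
  (cong (f zero - g zero +_) (Σℚ-diff (λ i → f (suc i)) (λ i → g (suc i))))
  (solve 4 (λ a b c d → (a :- b) :+ (c :- d) := (a :+ c) :- (b :+ d)) refl (f zero) (g zero) _ _)

Σℚ-nonNeg : ∀ {k} (f : Fin k → ℚ) → (∀ i → 0ℚ ≤ f i) → 0ℚ ≤ Σℚ f
Σℚ-nonNeg {zero}  f 0≤f = ≤-refl
Σℚ-nonNeg {suc k} f 0≤f = +-nonNeg (0≤f zero) (Σℚ-nonNeg (λ i → f (suc i)) (λ i → 0≤f (suc i)))

term≤Σℚ : ∀ {k} (f : Fin k → ℚ) → (∀ i → 0ℚ ≤ f i) → ∀ j → f j ≤ Σℚ f
term≤Σℚ {suc k} f 0≤f zero = subst (_≤ Σℚ f) (+-identityʳ (f zero))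
  (+-monoʳ-≤ (f zero) (Σℚ-nonNeg (λ i → f (suc i)) (λ i → 0≤f (suc i))))
term≤Σℚ {suc k} f 0≤f (suc j) = subst (_≤ Σℚ f) (+-identityˡ (f (suc j)))
  (+-mono-≤ (0≤f zero) (term≤Σℚ (λ i → f (suc i)) (λ i → 0≤f (suc i)) j))

single : ∀ {k} → Fin k → ℚ → Fin k → ℚ
single = upd (λ _ → 0ℚ)

single-elim : ∀ {k} (P : ℚ → Set) (i j : Fin k) x → (j ≡ i → P x) → (j ≢ i → P 0ℚ) → P (single i x j)
single-elim P i j x at-i elsewhere with j Fin.≟ i
... | yes j≡i = at-i j≡i
... | no j≢i  = elsewhere j≢i

single-nonNeg : ∀ {k} (i : Fin k) → 0ℚ ≤ p → ∀ j → 0ℚ ≤ single i p j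
single-nonNeg i 0≤p j = single-elim (0ℚ ≤_) i j _ (λ _ → 0≤p) (λ _ → ≤-refl)

single-zero : ∀ {k} (i j : Fin k) → single i 0ℚ j ≡ 0ℚ
single-zero i j = single-elim (_≡ 0ℚ) i j 0ℚ (λ _ → refl) (λ _ → refl)

Σℚ-single : ∀ {k} (i : Fin k) x → Σℚ (single i x) ≡ x
Σℚ-single {suc k} zero    x = trans (cong (x +_) (Σℚ-zero {k})) (+-identityʳ x)
Σℚ-single {suc k} (suc i) x = trans (cong (0ℚ +_) (Σℚ-single i x)) (+-identityˡ x)

Σℚ-single-comm : ∀ {k l} (j : Fin l) (f : Fin k → ℚ) y →
                 Σℚ (λ i → single j (f i) y) ≡ single j (Σℚ f) y
Σℚ-single-comm {k} j f y with y Fin.≟ j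
... | yes _ = refl
... | no _  = Σℚ-zero {k}

∨-true : ∀ a {b} → a ∨ b ≡ true → a ≡ true ⊎ b ≡ true
∨-true true  _ = inj₁ refl
∨-true false h = inj₂ h

module _ {m n : ℕ} where

  ==N-sound : (x y : Node m n) → (x ==N y) ≡ true → x ≡ y
  ==N-sound src    src     _ = refl
  ==N-sound snk    snk     _ = refl
  ==N-sound (nA a) (nA a') h with a Fin.≟ a'
  ... | yes refl = refl
  ==N-sound (nB b) (nB b') h with b Fin.≟ b'
  ... | yes refl = refl
  ==N-sound src    snk    ()
  ==N-sound src    (nA _) ()
  ==N-sound src    (nB _) ()
  ==N-sound snk    src    ()
  ==N-sound snk    (nA _) ()
  ==N-sound snk    (nB _) ()
  ==N-sound (nA _) src    ()
  ==N-sound (nA _) snk    ()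
  ==N-sound (nA _) (nB _) ()
  ==N-sound (nB _) src    ()
  ==N-sound (nB _) snk    ()
  ==N-sound (nB _) (nA _) ()

  ==N-refl : (x : Node m n) → (x ==N x) ≡ true
  ==N-refl src    = refl
  ==N-refl snk    = refl
  ==N-refl (nA a) = dec-true (a Fin.≟ a) refl
  ==N-refl (nB b) = dec-true (b Fin.≟ b) refl

  usesL⇒∈ : ∀ (L : List (Node m n)) u v → usesL L u v ≡ true → u ∈ L × v ∈ drop 1 L
  usesL⇒∈ []          u v ()
  usesL⇒∈ (x ∷ [])    u v ()
  usesL⇒∈ (x ∷ y ∷ L) u v h =
    [ at-head , Data.Product.map there there ∘ usesL⇒∈ (y ∷ L) u v ]′ (∨-true ((x ==N u) ∧ (y ==N v)) h)
    where
    at-head : (x ==N u) ∧ (y ==N v) ≡ true → u ∈ x ∷ y ∷ L × v ∈ y ∷ L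
    at-head xy≡uv = here (sym (==N-sound x u (∧-conicalˡ _ _ xy≡uv))) ,
                    here (sym (==N-sound y v (∧-conicalʳ _ _ xy≡uv)))

  usesL-∉ˡ : ∀ (L : List (Node m n)) {u} v → u ∉ L → usesL L u v ≡ false
  usesL-∉ˡ L v u∉L = ¬-not (λ h → u∉L (proj₁ (usesL⇒∈ L _ v h)))

  usesL-∉ʳ : ∀ (L : List (Node m n)) u {v} → v ∉ drop 1 L → usesL L u v ≡ false
  usesL-∉ʳ L u v∉L = ¬-not (λ h → v∉L (proj₂ (usesL⇒∈ L u _ h)))

  usesL-first : ∀ (x y : Node m n) L → usesL (x ∷ y ∷ L) x y ≡ true
  usesL-first x y L rewrite ==N-refl x | ==N-refl y = refl

  usesL-head : ∀ {x y : Node m n} {L z} → x ∉ y ∷ L → usesL (x ∷ y ∷ L) x z ≡ true → y ≡ z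
  usesL-head {x} {y} {L} {z} x∉yL h with ∨-true ((x ==N x) ∧ (y ==N z)) h
  ... | inj₁ xy≡xz = ==N-sound y z (∧-conicalʳ _ _ xy≡xz)
  ... | inj₂ later = ⊥-elim (x∉yL (proj₁ (usesL⇒∈ (y ∷ L) x z later)))

  nA-injective : ∀ {a a'} → nA {m} {n} a ≡ nA a' → a ≡ a'
  nA-injective refl = refl

module AugmentingPaths {m n : ℕ} (E : Fin m → Fin n → Bool) (Vp : Fin m → Bool)
                       (cA : Fin m → ℚ) (cB : Fin n → ℚ) where
  open Alg E Vp cA cB

  -- link a b P: the edge (a , b) of G, then the reverse residual edge from b to the start of P;
  -- last a b: the path a -> b -> t.
  data Chain : Fin m → Set where
    last : ∀ a (b : Fin n) → Chain a
    link : ∀ a (b : Fin n) {a'} → Chain a' → Chain a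

  private variable
    a : Fin m
    b : Fin n
    e : ℚ
    φ ψ : Flow m n

  bVertices : Chain a → List (Fin n)
  bVertices (last a b)   = b ∷ []
  bVertices (link a b P) = b ∷ bVertices P

  Residual : Flow m n → Chain a → Set
  Residual φ (last a b)        = E a b ≡ true × fB φ b < capB b
  Residual φ (link a b {a'} P) = E a b ≡ true × 0ℚ < fE φ a' b × Residual φ P

  ResidualBy : Flow m n → ℚ → Chain a → Set
  ResidualBy φ e (last a b)        = E a b ≡ true × fB φ b + e ≤ capB b
  ResidualBy φ e (link a b {a'} P) = E a b ≡ true × e ≤ fE φ a' b × ResidualBy φ e P

  residualBy-transfer : (P : Chain a) → (∀ y → fB ψ y ≡ fB φ y) →
                        (∀ x {y} → y ∈ bVertices P → fE ψ x y ≡ fE φ x y) →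
                        ResidualBy φ e P → ResidualBy ψ e P
  residualBy-transfer {e = e} (last a b) fB≗ _ (eab , slack) =
    eab , subst (λ f → f + e ≤ capB b) (sym (fB≗ b)) slack
  residualBy-transfer {e = e} (link a b {a'} P) fB≗ fE≗ (eab , e≤ , rP) =
    eab , subst (e ≤_) (sym (fE≗ a' (here refl))) e≤ ,
    residualBy-transfer P fB≗ (λ x y∈P → fE≗ x (there y∈P)) rP

  record AugmentingChain (p : Prices) (φ : Flow m n) : Set where
    field
      start    : Fin m
      slack    : fA φ start < capA p start
      chain    : Chain start
      residual : Residual φ chain

  module _ {p : Prices} {φ : Flow m n} where

    mutual
      walk⇒augmentingChain : Walk p φ src snk → AugmentingChain p φ
      walk⇒augmentingChain (s→a {a} slack ◅ W) with walkFromA W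
      ... | inj₁ (P , rP) = record { slack = slack ; chain = P ; residual = rP }
      ... | inj₂ C        = C

      walkFromA : Walk p φ (nA a) snk → Σ (Chain a) (Residual φ) ⊎ AugmentingChain p φ
      walkFromA (a→s _ ◅ W) = inj₂ (walk⇒augmentingChain W)
      walkFromA (a→b {a} {b} eab ◅ W) with walkFromB W
      ... | inj₁ (_ , P , pos , rP) = inj₁ (link a b P , eab , pos , rP)
      ... | inj₂ (inj₁ slack)       = inj₁ (last a b , eab , slack)
      ... | inj₂ (inj₂ C)           = inj₂ C

      walkFromB : Walk p φ (nB b) snk →
                  (∃ λ a → Σ (Chain a) λ P → 0ℚ < fE φ a b × Residual φ P) ⊎
                  fB φ b < capB b ⊎ AugmentingChain p φ
      walkFromB (b→a pos ◅ W) with walkFromA W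
      ... | inj₁ (P , rP) = inj₁ (_ , P , pos , rP)
      ... | inj₂ C        = inj₂ (inj₂ C)
      walkFromB (b→t slack ◅ W) = inj₂ (inj₁ slack)

  module _ {φ : Flow m n} where

    shortcut : E a b ≡ true → ∀ {a'} (P : Chain a') → Residual φ P → Unique (bVertices P) →
               All (b ≢_) (bVertices P) ⊎ Σ (Chain a) λ Q → Residual φ Q × Unique (bVertices Q)
    shortcut {a} {b} eab (last _ b₁) (_ , slack) _ with b Fin.≟ b₁
    ... | yes refl  = inj₂ (last a b , (eab , slack) , [] ∷ [])
    ... | no b≢b₁   = inj₁ (b≢b₁ ∷ [])
    shortcut {a} {b} eab (link _ b₁ P) (_ , pos , rP) (b₁∉P ∷ uP) with b Fin.≟ b₁
    ... | yes refl  = inj₂ (link a b P , (eab , pos , rP) , (b₁∉P ∷ uP))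
    ... | no b≢b₁   = Data.Sum.map (b≢b₁ ∷_) id (shortcut eab P rP uP)

    -- Distinct B-vertices keep the column updates made by push independent of one another.
    removeLoops : (P : Chain a) → Residual φ P → Σ (Chain a) λ Q → Residual φ Q × Unique (bVertices Q)
    removeLoops (last a b) rP = last a b , rP , [] ∷ []
    removeLoops (link a b P) (eab , pos , rP) with removeLoops P rP
    ... | Q , rQ , uQ with shortcut eab Q rQ uQ
    ...   | inj₁ b∉Q = link a b Q , (eab , pos , rQ) , (b∉Q ∷ uQ)
    ...   | inj₂ Q'  = Q'

    bottleneck : Chain a → ℚ
    bottleneck (last a b)        = capB b - fB φ b
    bottleneck (link a b {a'} P) = fE φ a' b ⊓ bottleneck P

    bottleneck-pos : (P : Chain a) → Residual φ P → 0ℚ < bottleneck P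
    bottleneck-pos (last a b)   (_ , slack)    = p<q⇒0<q-p slack
    bottleneck-pos (link a b P) (_ , pos , rP) = ⊓-pos pos (bottleneck-pos P rP)

    residualBy-bottleneck : (P : Chain a) → Residual φ P → e ≤ bottleneck P → ResidualBy φ e P
    residualBy-bottleneck (last a b) (eab , _) e≤ = eab , r≤q-p⇒p+r≤q e≤
    residualBy-bottleneck (link a b {a'} P) (eab , _ , rP) e≤ =
      eab , p≤q⊓r⇒p≤q (fE φ a' b) (bottleneck P) e≤ ,
      residualBy-bottleneck P rP (p≤q⊓r⇒p≤r (fE φ a' b) (bottleneck P) e≤)

  addColumn : Fin n → (Fin m → ℚ) → Flow m n → Flow m n
  addColumn b D ψ = record ψ { fE = λ x y → fE ψ x y + single b (D x) y }

  module AddColumn (b : Fin n) (D : Fin m → ℚ) (ψ : Flow m n) where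

    elim : ∀ (P : ℚ → Set) x y → (y ≡ b → P (fE ψ x y + D x)) → (y ≢ b → P (fE ψ x y)) →
           P (fE (addColumn b D ψ) x y)
    elim P x y in-b elsewhere = single-elim (λ z → P (fE ψ x y + z)) b y (D x) in-b
      (λ y≢b → subst P (sym (+-identityʳ (fE ψ x y))) (elsewhere y≢b))

    rowSum : ∀ x → Σℚ (fE (addColumn b D ψ) x) ≡ Σℚ (fE ψ x) + D x
    rowSum x = trans (Σℚ-+ (fE ψ x) (single b (D x))) (cong (Σℚ (fE ψ x) +_) (Σℚ-single b (D x)))

    colSum : ∀ y → Σℚ (λ x → fE (addColumn b D ψ) x y) ≡ Σℚ (λ x → fE ψ x y) + single b (Σℚ D) y
    colSum y = trans (Σℚ-+ (λ x → fE ψ x y) (λ x → single b (D x) y))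
                               (cong (Σℚ (λ x → fE ψ x y) +_) (Σℚ-single-comm b D y))

    residualBy : (P : Chain a) → All (b ≢_) (bVertices P) → ResidualBy ψ e P → ResidualBy (addColumn b D ψ) e P
    residualBy P b∉P = residualBy-transfer P (λ _ → refl)
      (λ x y∈P → elim (_≡ fE ψ x _) x _ (λ y≡b → ⊥-elim (All.lookup b∉P y∈P (sym y≡b))) (λ _ → refl))

  inject : Fin m → ℚ → Flow m n → Flow m n
  inject a e φ = record φ { fA = λ x → fA φ x + single a e x }

  reroute : Fin m → Fin n → Fin m → ℚ → Flow m n → Flow m n
  reroute a b a' e = addColumn b (λ x → single a e x - single a' e x)

  drain : Fin m → Fin n → ℚ → Flow m n → Flow m n
  drain a b e ψ = record (addColumn b (single a e) ψ) { fB = λ y → fB ψ y + single b e y }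

  push : Chain a → ℚ → Flow m n → Flow m n
  push (last a b)        e ψ = drain a b e ψ
  push (link a b {a'} P) e ψ = push P e (reroute a b a' e ψ)

  push-value : (P : Chain a) → value (push P e ψ) ≡ value ψ
  push-value (last a b)   = refl
  push-value (link a b P) = push-value P

  single-off-edge : ∀ {x} → E a b ≡ true → E x b ≡ false → single a e x ≡ 0ℚ
  single-off-edge {a} {b} {e} {x} eab ¬exb =
    single-elim (_≡ 0ℚ) a x e (λ { refl → contradiction (trans (sym eab) ¬exb) λ () }) (λ _ → refl)

  record Preflow (p : Prices) (ψ : Flow m n) (a : Fin m) (e : ℚ) : Set where
    field
      fA-nonneg : ∀ x → 0ℚ ≤ fA ψ x
      fA-cap    : ∀ x → fA ψ x ≤ capA p x
      fB-nonneg : ∀ y → 0ℚ ≤ fB ψ y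
      fB-cap    : ∀ y → fB ψ y ≤ capB y
      fE-nonneg : ∀ x y → 0ℚ ≤ fE ψ x y
      fE-edge   : ∀ x y → E x y ≡ false → fE ψ x y ≡ 0ℚ
      cons-B    : ∀ y → Σℚ (λ x → fE ψ x y) ≡ fB ψ y
      excess-A  : ∀ x → fA ψ x ≡ Σℚ (fE ψ x) + single a e x

  inject-preflow : ∀ {p} → Feasible p φ → 0ℚ ≤ e → e ≤ capA p a - fA φ a → Preflow p (inject a e φ) a e
  inject-preflow {φ} {e} {a} {p} F 0≤e e≤slack = record
    { fA-nonneg = λ x → +-nonNeg (fA-nonneg x) (single-nonNeg a 0≤e x)
    ; fA-cap    = λ x → single-elim (λ z → fA φ x + z ≤ capA p x) a x e
                          (λ { refl → r≤q-p⇒p+r≤q e≤slack })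
                          (λ _ → subst (_≤ capA p x) (sym (+-identityʳ (fA φ x))) (fA-cap x))
    ; fB-nonneg = fB-nonneg
    ; fB-cap    = fB-cap
    ; fE-nonneg = fE-nonneg
    ; fE-edge   = fE-edge
    ; cons-B    = cons-B
    ; excess-A  = λ x → cong (_+ single a e x) (cons-A x)
    }
    where open Feasible F

  reroute-preflow : ∀ {p a'} → Preflow p ψ a e → 0ℚ < e → E a b ≡ true → e ≤ fE ψ a' b →
                    Preflow p (reroute a b a' e ψ) a' e
  reroute-preflow {ψ} {a} {e} {b} {p} {a'} pre 0<e eab e≤ = record
    { fA-nonneg = fA-nonneg
    ; fA-cap    = fA-cap
    ; fB-nonneg = fB-nonneg
    ; fB-cap    = fB-cap
    ; fE-nonneg = λ x y → elim (0ℚ ≤_) x y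
                            (λ { refl → 0≤q+[r-p] (outflow≤ x) (single-nonNeg a (<⇒≤ 0<e) x) })
                            (λ _ → fE-nonneg x y)
    ; fE-edge   = λ x y ¬exy → elim (_≡ 0ℚ) x y (λ { refl → column-edge x ¬exy }) (λ _ → fE-edge x y ¬exy)
    ; cons-B    = λ y → begin
        Σℚ (λ x → fE ψ' x y)                     ≡⟨ colSum y ⟩
        Σℚ (λ x → fE ψ x y) + single b (Σℚ D) y  ≡⟨ cong₂ (λ s t → s + single b t y) (cons-B y) ΣD≡0 ⟩
        fB ψ y + single b 0ℚ y                    ≡⟨ cong (fB ψ y +_) (single-zero b y) ⟩
        fB ψ y + 0ℚ                               ≡⟨ +-identityʳ (fB ψ y) ⟩
        fB ψ y                                    ∎
    ; excess-A  = λ x → begin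
        fA ψ x                                    ≡⟨ excess-A x ⟩
        Σℚ (fE ψ x) + single a e x                ≡⟨ solve 3 (λ s u w → s :+ u := (s :+ (u :- w)) :+ w) refl
                                                       (Σℚ (fE ψ x)) (single a e x) (single a' e x) ⟩
        (Σℚ (fE ψ x) + D x) + single a' e x       ≡⟨ cong (_+ single a' e x) (rowSum x) ⟨
        Σℚ (fE ψ' x) + single a' e x              ∎
    }
    where
    open Preflow pre
    open ≡-Reasoning
    D : Fin m → ℚ
    D x = single a e x - single a' e x
    open AddColumn b D ψ
    ψ' = reroute a b a' e ψ
    ΣD≡0 : Σℚ D ≡ 0ℚ
    ΣD≡0 = trans (Σℚ-diff (single a e) (single a' e))
                 (trans (cong₂ _-_ (Σℚ-single a e) (Σℚ-single a' e)) (+-inverseʳ e))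
    outflow≤ : ∀ x → single a' e x ≤ fE ψ x b
    outflow≤ x = single-elim (_≤ fE ψ x b) a' x e (λ { refl → e≤ }) (λ _ → fE-nonneg x b)
    column-edge : ∀ x → E x b ≡ false → fE ψ x b + D x ≡ 0ℚ
    column-edge x ¬exb = cong₂ _+_ (fE-edge x b ¬exb) (cong₂ _-_ (single-off-edge eab ¬exb) not-a')
      where
      not-a' : single a' e x ≡ 0ℚ
      not-a' = single-elim (_≡ 0ℚ) a' x e
                 (λ { refl → contradiction (subst (e ≤_) (fE-edge x b ¬exb) e≤) (<⇒≱ 0<e) }) (λ _ → refl)

  drain-feasible : ∀ {p} → Preflow p ψ a e → 0ℚ ≤ e → E a b ≡ true → fB ψ b + e ≤ capB b →
                   Feasible p (drain a b e ψ)
  drain-feasible {ψ} {a} {e} {b} pre 0≤e eab slack = record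
    { fA-nonneg = fA-nonneg
    ; fA-cap    = fA-cap
    ; fB-nonneg = λ y → +-nonNeg (fB-nonneg y) (single-nonNeg b 0≤e y)
    ; fB-cap    = λ y → single-elim (λ z → fB ψ y + z ≤ capB y) b y e (λ { refl → slack })
                          (λ _ → subst (_≤ capB y) (sym (+-identityʳ (fB ψ y))) (fB-cap y))
    ; fE-nonneg = λ x y → elim (0ℚ ≤_) x y (λ { refl → +-nonNeg (fE-nonneg x b) (single-nonNeg a 0≤e x) })
                                            (λ _ → fE-nonneg x y)
    ; fE-edge   = λ x y ¬exy → elim (_≡ 0ℚ) x y (λ { refl → column-edge x ¬exy }) (λ _ → fE-edge x y ¬exy)
    ; cons-A    = λ x → trans (excess-A x) (sym (rowSum x))
    ; cons-B    = λ y → trans (colSum y) (cong₂ (λ s t → s + single b t y) (cons-B y) (Σℚ-single a e))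
    }
    where
    open Preflow pre
    open AddColumn b (single a e) ψ
    column-edge : ∀ x → E x b ≡ false → fE ψ x b + single a e x ≡ 0ℚ
    column-edge x ¬exb = cong₂ _+_ (fE-edge x b ¬exb) (single-off-edge eab ¬exb)

  push-feasible : ∀ {p} → Preflow p ψ a e → 0ℚ < e →
                  (P : Chain a) → ResidualBy ψ e P → Unique (bVertices P) →
                  Feasible p (push P e ψ)
  push-feasible pre 0<e (last a b) (eab , slack) _ = drain-feasible pre (<⇒≤ 0<e) eab slack
  push-feasible {ψ} {e = e} pre 0<e (link a b {a'} P) (eab , e≤ , rP) (b∉P ∷ uP) =
    push-feasible (reroute-preflow pre 0<e eab e≤) 0<e P
      (AddColumn.residualBy b (λ x → single a e x - single a' e x) ψ P b∉P rP) uP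

  maxFlow⇒¬augmentingWalk : ∀ {p} → MaxFlow p φ → ¬ Walk p φ src snk
  maxFlow⇒¬augmentingWalk {φ} {p} (feasible , maximal) W =
    <⇒≱ (p<p+q 0<δ) (subst (_≤ value φ) value-pushed (maximal _ pushed-feasible))
    where
    open AugmentingChain (walk⇒augmentingChain W)
    loopFree = removeLoops chain residual
    Q : Chain start
    Q = proj₁ loopFree
    rQ : Residual φ Q
    rQ = proj₁ (proj₂ loopFree)
    sourceSlack = capA p start - fA φ start
    δ : ℚ
    δ = sourceSlack ⊓ bottleneck Q
    0<δ : 0ℚ < δ
    0<δ = ⊓-pos (p<q⇒0<q-p slack) (bottleneck-pos Q rQ)
    along : ResidualBy (inject start δ φ) δ Q
    along = residualBy-transfer Q (λ _ → refl) (λ _ _ → refl) (residualBy-bottleneck Q rQ (p⊓q≤q sourceSlack _))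
    pushed-feasible : Feasible p (push Q δ (inject start δ φ))
    pushed-feasible =
      push-feasible (inject-preflow feasible (<⇒≤ 0<δ) (p⊓q≤p sourceSlack _)) 0<δ
                    Q along (proj₂ (proj₂ loopFree))
    value-pushed : value (push Q δ (inject start δ φ)) ≡ value φ + δ
    value-pushed = trans (push-value Q)
      (trans (Σℚ-+ (fA φ) (single start δ)) (cong (value φ +_) (Σℚ-single start δ)))

module CutInvariant {m n : ℕ} (E : Fin m → Fin n → Bool) (Vp : Fin m → Bool)
                    (cA : Fin m → ℚ) (cB : Fin n → ℚ) where
  open Alg E Vp cA cB
  open AugmentingPaths E Vp cA cB using (maxFlow⇒¬augmentingWalk)

  record ClosedCut (p : Prices) (φ : Flow m n) : Set₁ where
    field
      S           : Node m n → Set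
      src∈S       : S src
      snk∉S       : ¬ S snk
      priceable∉S : ∀ v → Vp v ≡ true → ¬ S (nA v)
      closed      : ∀ {u x} → S u → Res p φ u x → S x

    closed-walk : ∀ {x y} → Walk p φ x y → S x → S y
    closed-walk ε        Sx = Sx
    closed-walk (r ◅ W)  Sx = closed-walk W (closed Sx r)

  Res-reprice : ∀ {p q φ u x} → Res q φ u x → u ≢ src → Res p φ u x
  Res-reprice (s→a _)   u≢src = ⊥-elim (u≢src refl)
  Res-reprice (a→s h)   _     = a→s h
  Res-reprice (a→b h)   _     = a→b h
  Res-reprice (b→a h)   _     = b→a h
  Res-reprice (b→t h)   _     = b→t h
  Res-reprice (t→b h)   _     = t→b h

  module _ {p φ} (C : ClosedCut p φ) where
    open ClosedCut C

    closed-walk-avoiding-src : ∀ {q x y} (W : Walk q φ x y) → src ∉ nodes W → S x → S y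
    closed-walk-avoiding-src ε       _       Sx = Sx
    closed-walk-avoiding-src (r ◅ W) src∉rW Sx =
      closed-walk-avoiding-src W (src∉rW ∘ there) (closed Sx (Res-reprice r (src∉rW ∘ here ∘ sym)))

    walk-to-snk-avoids-S : ∀ {q x} (W : Walk q φ x snk) → src ∉ nodes W → All (¬_ ∘ S) (nodes W)
    walk-to-snk-avoids-S ε       _      = snk∉S ∷ []
    walk-to-snk-avoids-S (r ◅ W) src∉rW =
      (snk∉S ∘ closed-walk-avoiding-src (r ◅ W) src∉rW) ∷ walk-to-snk-avoids-S W (src∉rW ∘ there)

  if-priceable : ∀ {v} {x y : ℚ} → Vp v ≡ true → (if Vp v then x else y) ≡ x
  if-priceable vp = cong (if_then _ else _) vp

  no-residual-edge-into-priceable : ∀ {φ u v} → Feasible p₀ φ → Vp v ≡ true → ¬ Res p₀ φ u (nA v)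
  no-residual-edge-into-priceable {φ} {v = v} F vp (s→a h) =
    <⇒≱ (subst (fA φ v <_) (if-priceable vp) h) (fA-nonneg v)
    where open Feasible F
  no-residual-edge-into-priceable {φ} {v = v} F vp (b→a {b = b} h) = <⇒≱ h (begin
    fE φ v b         ≤⟨ term≤Σℚ (fE φ v) (fE-nonneg v) b ⟩
    Σℚ (fE φ v)      ≡⟨ cons-A v ⟨
    fA φ v           ≤⟨ fA-cap v ⟩
    capA p₀ v        ≡⟨ if-priceable vp ⟩
    0ℚ               ∎)
    where
    open Feasible F
    open ≤-Reasoning

  reachable-cut : ∀ {φ₀} → MaxFlow p₀ φ₀ → ClosedCut p₀ φ₀
  reachable-cut {φ₀} maxFlow@(F , _) = record
    { S           = Walk p₀ φ₀ src
    ; src∈S       = ε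
    ; snk∉S       = maxFlow⇒¬augmentingWalk maxFlow
    ; priceable∉S = λ v vp W → case walk-into-priceable vp W refl of λ ()
    ; closed      = λ W r → W ◅◅ (r ◅ ε)
    }
    where
    walk-into-priceable : ∀ {v x y} → Vp v ≡ true → Walk p₀ φ₀ x y → y ≡ nA v → x ≡ nA v
    walk-into-priceable vp ε       y≡v = y≡v
    walk-into-priceable vp (r ◅ W) y≡v =
      ⊥-elim (no-residual-edge-into-priceable F vp (subst (Res p₀ φ₀ _) (walk-into-priceable vp W y≡v) r))

  shift-unused : ∀ x δ {b c} → b ≡ false → c ≡ false → (x + shift b δ) - shift c δ ≡ x
  shift-unused x δ refl refl = solve 1 (λ x → (x :+ con 0ℚ) :- con 0ℚ := x) refl x

  shift-forward : ∀ x δ {b c} → b ≡ true → c ≡ false → (x + shift b δ) - shift c δ ≡ x + δ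
  shift-forward x δ refl refl = solve 2 (λ x δ → (x :+ δ) :- con 0ℚ := x :+ δ) refl x δ

  augment-preserves-cut : ∀ {p φ v Δ δ} (W : Walk (upd p v (p v + Δ)) φ (nA v) snk) →
                          Vp v ≡ true → src ∉ nodes W →
                          ClosedCut p φ → ClosedCut (upd p v (p v + δ)) (augment φ (src ∷ nodes W) δ)
  augment-preserves-cut {p} {φ} {v} {δ = δ} W@(_ ◅ W') vp src∉W C = record
    { S = S ; src∈S = src∈S ; snk∉S = snk∉S ; priceable∉S = priceable∉S ; closed = closed′ }
    where
    open ClosedCut C
    L = src ∷ nodes W
    ∉W : ∀ {u} → S u → u ∉ nodes W
    ∉W Su u∈W = All.lookup (walk-to-snk-avoids-S C W src∉W) u∈W Su
    ∉L : ∀ {u} → S u → u ≢ src → u ∉ L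
    ∉L _  u≢src (here u≡src) = u≢src u≡src
    ∉L Su _     (there u∈W)  = ∉W Su u∈W
    closed′ : ∀ {u x} → S u → Res (upd p v (p v + δ)) (augment φ L δ) u x → S x
    closed′ Su (s→a {a} h) with a Fin.≟ v
    ... | yes refl = closed Su (s→a (subst (fA φ v <_) (sym (if-priceable vp)) (+-cancelʳ-< δ raised)))
      where
      raised : fA φ v + δ < p v + δ
      raised = subst₂ _<_ (shift-forward (fA φ v) δ (usesL-first src (nA v) (nodes W')) (usesL-∉ʳ L (nA v) src∉W))
                          (if-priceable vp) h
    ... | no a≢v = closed Su (s→a (subst (_< capA p a) (shift-unused (fA φ a) δ
                      (¬-not (a≢v ∘ sym ∘ nA-injective ∘ usesL-head src∉W)) (usesL-∉ʳ L (nA a) src∉W)) h))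
    closed′ _  (a→s _)   = src∈S
    closed′ Su (a→b eab) = closed Su (a→b eab)
    closed′ Su (b→a {a} {b} h) = closed Su (b→a (subst (0ℚ <_)
      (shift-unused (fE φ a b) δ (usesL-∉ʳ L (nA a) (∉W Su)) (usesL-∉ˡ L (nA a) (∉L Su λ ()))) h))
    closed′ Su (b→t {b} h) = closed Su (b→t (subst (_< capB b)
      (shift-unused (fB φ b) δ (usesL-∉ˡ L snk (∉L Su λ ())) (usesL-∉ʳ L snk (∉W Su))) h))
    closed′ Su (t→b _) = ⊥-elim (snk∉S Su)

  CutAt : State → Set₁
  CutAt (φ , p) = ClosedCut p φ

  step-preserves-cut : ∀ {s t} → Step s t → CutAt s → CutAt t
  step-preserves-cut (step v _ (s→a {a} h ◅ W@(_ ◅ _)) δ vp _ (src∉W ∷ _) _ _) C with a Fin.≟ v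
  ... | yes refl = augment-preserves-cut W vp (All¬⇒¬Any src∉W) C
  ... | no a≢v   = ⊥-elim (All.head (walk-to-snk-avoids-S C W (All¬⇒¬Any src∉W)) (closed src∈S (s→a h)))
    where open ClosedCut C

  run-preserves-cut : ∀ {s t} → Star Step s t → CutAt s → CutAt t
  run-preserves-cut ε          C = C
  run-preserves-cut (st ◅ run) C = run-preserves-cut run (step-preserves-cut st C)

lemma4p4 : ∀ {m n} (E : Fin m → Fin n → Bool) (Vp : Fin m → Bool)
             (cA : Fin m → ℚ) (cB : Fin n → ℚ) →
             (∀ a → 0ℚ ≤ cA a) → (∀ b → 0ℚ ≤ cB b) →
             ∀ φ p → Alg.FinalState E Vp cA cB φ p →
             ∀ v → Vp v ≡ true → Alg.InCoverA E Vp cA cB p φ v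
lemma4p4 E Vp cA cB _ _ φ p ((φ₀ , maxFlow₀ , run) , _) v vp (W , _) =
  priceable∉S v vp (closed-walk W src∈S)
  where
  open CutInvariant E Vp cA cB
  open ClosedCut (run-preserves-cut run (reachable-cut maxFlow₀))
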